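{- For integers $j\geq 3$ and $n\geq j$, $m_j(nK_2,C_7) \geq \lceil \frac{2n+2}{j}\rceil$.
   Context: $K_{j\times t}$ denotes the complete multipartite graph with $j$ partite classes of size $t$. $m_j(G_1,G_2)$ is the smallest positive integer $t$ such that every 2-coloring of the edges of $K_{j\times t}$ contains a copy of $G_1$ in color 1 or a copy of $G_2$ in color 2. $nK_2$ is the matching of $n$ disjoint edges and $C_7$ the cycle on 7 vertices. -}

module Defs where

open import Level using (0ℓ)
open import Data.Nat using (ℕ; suc; _+_; _*_; _∸_; _≤_; NonZero)
open import Data.Nat.DivMod using (_/_; _%_)
open import Data.Fin using (Fin; toℕ; zero; suc)
open import Data.Product using (_×_; Σ; _,_)
open import Data.Sum using (_⊎_)
open import Relation.Binary.PropositionalEquality using (_≡_; _≢_)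
open import Function.Definitions using (Injective)

record Graph : Set₁ where
  field
    V   : Set
    Adj : V → V → Set

open Graph public

-- Complete multipartite graph K_{j×t}: vertex (a , x) lies in part a;
-- two vertices are adjacent iff they lie in different parts.
K[_×_] : ℕ → ℕ → Graph
K[ j × t ] = record
  { V   = Fin j × Fin t
  ; Adj = λ { (a , x) (b , y) → a ≢ b } }

-- Matching nK₂: vertices (i , s), i < n, s ∈ {0,1}; edges {(i,0),(i,1)}.
matching : ℕ → Graph
matching n = record
  { V   = Fin n × Fin 2
  ; Adj = λ { (i , s) (k , r) → i ≡ k × s ≢ r } }

-- Cycle C_k on vertices 0,…,k-1 with edges {i, i+1 mod k}  (k ≥ 3).
cycle : (k : ℕ) → .{{NonZero k}} → Graph
cycle k = record
  { V   = Fin k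
  ; Adj = λ u v → ((toℕ u + 1) % k ≡ toℕ v) ⊎ ((toℕ v + 1) % k ≡ toℕ u) }

C₇ : Graph
C₇ = cycle 7

-- A 2-colouring of the edges of H: a colour (Fin 2; zero = colour 1,
-- suc zero = colour 2) for each pair of vertices, symmetric, so that each
-- (unordered) edge receives a single colour.  Values on non-edges are irrelevant.
record TwoColouring (H : Graph) : Set where
  field
    colour : V H → V H → Fin 2
    sym    : ∀ u v → colour u v ≡ colour v u

open TwoColouring public

MonoCopy : (G H : Graph) → TwoColouring H → Fin 2 → Set
MonoCopy G H χ c =
  Σ (V G → V H) λ f →
    Injective _≡_ _≡_ f ×
    (∀ u v → Adj G u v → Adj H (f u) (f v) × colour χ (f u) (f v) ≡ c)

Arrows : ℕ → ℕ → Graph → Graph → Set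
Arrows j t G₁ G₂ =
  (χ : TwoColouring K[ j × t ]) →
    MonoCopy G₁ K[ j × t ] χ zero ⊎ MonoCopy G₂ K[ j × t ] χ (suc zero)

IsMultipartiteRamsey : ℕ → Graph → Graph → ℕ → Set
IsMultipartiteRamsey j G₁ G₂ m =
  1 ≤ m × Arrows j m G₁ G₂ × (∀ t → 1 ≤ t → Arrows j t G₁ G₂ → m ≤ t)

⌈_/_⌉ : ℕ → (b : ℕ) → .{{NonZero b}} → ℕ
⌈ a / b ⌉ = (a + b ∸ 1) / b

{-# OPTIONS --safe #-}
-- Suppose j·m ≤ 2n + 1.  Number the vertices of K_{j×m} by 0, …, jm − 1 and colour an
-- edge red iff both ends have number < 2n − 1.  The red graph then has fewer than 2n
-- vertices, so contains no nK₂; every blue edge meets one of the at most two remaining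
-- vertices, while C₇ contains three disjoint edges.  Hence j·m ≥ 2n + 2.
module Submission where

open import Defs
open import Data.Bool using (Bool; true; false; T; _∧_; if_then_else_)
open import Data.Bool.Properties using (∧-comm)
open import Data.Empty using (⊥-elim)
open import Data.Fin using (Fin; toℕ; fromℕ<; inject₁; combine; remQuot)
open import Data.Fin.Patterns using (0F; 1F; 2F)
open import Data.Fin.Properties
  using (toℕ<n; toℕ-injective; fromℕ<-injective; inject₁-injective;
         combine-injective; injective⇒≤; *↔×)
open import Data.Nat
  using (ℕ; zero; suc; _+_; _*_; _∸_; _%_; _≤_; _<_; _<ᵇ_; s≤s; z≤n; >-nonZero)
open import Data.Nat.DivMod using (m<n*o⇒m/o<n)
open import Data.Nat.Properties
  using (≤-trans; <ᵇ⇒<; <⇒<ᵇ; ≮⇒≥; <⇒≱; ≤-pred; n<1+n; ∸-monoˡ-<; ∸-cancelʳ-≡;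
         m≤n+o⇒m∸n≤o; +-suc; +-comm; *-comm; +-monoʳ-≤; module ≤-Reasoning)
open import Data.Nat.Tactic.RingSolver using (solve-∀)
open import Data.Product using (_×_; _,_; proj₁; proj₂; Σ)
open import Data.Sum using (_⊎_; inj₁; inj₂; [_,_]′)
open import Function using (_∘_)
open import Function.Bundles using (Injection)
open import Function.Definitions using (Injective)
open import Function.Properties.Inverse using (↔⇒↣)
open import Relation.Nullary using (¬_)
open import Relation.Binary.PropositionalEquality using (_≡_; refl; cong; subst)

Embedding : Graph → Graph → Set
Embedding G H =
  Σ (V G → V H) λ e →
    Injective _≡_ _≡_ e × (∀ u v → Adj G u v → Adj H (e u) (e v))

MonoCopy-∘ : ∀ {G G′ H χ c} → Embedding G G′ → MonoCopy G′ H χ c → MonoCopy G H χ c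
MonoCopy-∘ (e , e-inj , e-adj) (f , f-inj , f-adj) =
  f ∘ e , e-inj ∘ f-inj , λ u v uv → f-adj (e u) (e v) (e-adj u v uv)

matching3↪C₇ : Embedding (matching 3) C₇
matching3↪C₇ = end , end-injective , adjacent
  where
  end : Fin 3 × Fin 2 → Fin 7
  end (i , s) = inject₁ (combine i s)

  end-injective : Injective _≡_ _≡_ end
  end-injective {i , s} {k , r} eq with combine-injective i s k r (inject₁-injective eq)
  ... | refl , refl = refl

  consecutive : ∀ i → (toℕ (end (i , 0F)) + 1) % 7 ≡ toℕ (end (i , 1F))
  consecutive 0F = refl
  consecutive 1F = refl
  consecutive 2F = refl

  adjacent : ∀ u v → Adj (matching 3) u v → Adj C₇ (end u) (end v)
  adjacent (i , 0F) (.i , 0F) (refl , s≢r) = ⊥-elim (s≢r refl)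
  adjacent (i , 0F) (.i , 1F) (refl , _)   = inj₁ (consecutive i)
  adjacent (i , 1F) (.i , 0F) (refl , _)   = inj₂ (consecutive i)
  adjacent (i , 1F) (.i , 1F) (refl , s≢r) = ⊥-elim (s≢r refl)

splitColouring : (H : Graph) → (V H → Bool) → TwoColouring H
splitColouring H low = record
  { colour = λ u v → if low u ∧ low v then 0F else 1F
  ; sym    = λ u v → cong (λ b → if b then 0F else 1F) (∧-comm (low u) (low v))
  }

module _ {H : Graph} (low : V H → Bool) where

  red⇒low : ∀ {u v} → colour (splitColouring H low) u v ≡ 0F → T (low u)
  red⇒low {u} {v} red with low u | low v
  red⇒low _  | true  | true  = _
  red⇒low () | true  | false
  red⇒low () | false | _

  blue⇒high : ∀ {u v} → colour (splitColouring H low) u v ≡ 1F → ¬ T (low u) ⊎ ¬ T (low v)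
  blue⇒high {u} {v} blue with low u | low v
  blue⇒high () | true  | true
  blue⇒high _  | true  | false = inj₂ λ ()
  blue⇒high _  | false | _     = inj₁ λ ()

module ThresholdColouring {H : Graph} {N : ℕ}
  (number : V H → Fin N) (number-injective : Injective _≡_ _≡_ number) (K : ℕ) where

  rank : V H → ℕ
  rank v = toℕ (number v)

  below : V H → Bool
  below v = rank v <ᵇ K

  colouring : TwoColouring H
  colouring = splitColouring H below

  rank-injective : ∀ {u v} → rank u ≡ rank v → u ≡ v
  rank-injective = number-injective ∘ toℕ-injective

  red⇒rank< : ∀ {u v} → colour colouring u v ≡ 0F → rank u < K
  red⇒rank< {u} {v} red = <ᵇ⇒< (rank u) K (red⇒low {H} below {u} {v} red)

  blue⇒rank≥ : ∀ {u v} → colour colouring u v ≡ 1F → K ≤ rank u ⊎ K ≤ rank v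
  blue⇒rank≥ {u} {v} blue with blue⇒high {H} below {u} {v} blue
  ... | inj₁ high = inj₁ (≮⇒≥ (high ∘ <⇒<ᵇ))
  ... | inj₂ high = inj₂ (≮⇒≥ (high ∘ <⇒<ᵇ))

  redMatching⇒2n≤K : ∀ {n} → MonoCopy (matching n) H colouring 0F → n * 2 ≤ K
  redMatching⇒2n≤K {n} (f , f-inj , f-adj) = injective⇒≤ slot-injective
    where
    rank<K : ∀ p → rank (f p) < K
    rank<K (i , 0F) = red⇒rank< (proj₂ (f-adj (i , 0F) (i , 1F) (refl , λ ())))
    rank<K (i , 1F) = red⇒rank< (proj₂ (f-adj (i , 1F) (i , 0F) (refl , λ ())))

    slot : Fin (n * 2) → Fin K
    slot k = fromℕ< (rank<K (remQuot 2 k))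

    slot-injective : Injective _≡_ _≡_ slot
    slot-injective = Injection.injective (↔⇒↣ (*↔× {n} {2}))
                   ∘ f-inj ∘ rank-injective ∘ fromℕ<-injective _ _ _ _

  -- Every blue edge has an end of rank ≥ K: the N ∸ K top vertices cover all blue edges.
  blueMatching⇒k≤N∸K : ∀ {k} → MonoCopy (matching k) H colouring 1F → k ≤ N ∸ K
  blueMatching⇒k≤N∸K {k} (f , f-inj , f-adj) = injective⇒≤ slot-injective
    where
    highEnd : ∀ i → Σ (Fin 2) λ s → K ≤ rank (f (i , s))
    highEnd i with blue⇒rank≥ (proj₂ (f-adj (i , 0F) (i , 1F) (refl , λ ())))
    ... | inj₁ high = 0F , high
    ... | inj₂ high = 1F , high

    end : Fin k → V H
    end i = f (i , proj₁ (highEnd i))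

    slot : Fin k → Fin (N ∸ K)
    slot i = fromℕ< (∸-monoˡ-< (toℕ<n (number (end i))) (proj₂ (highEnd i)))

    slot-injective : Injective _≡_ _≡_ slot
    slot-injective {i} {i′} =
      cong proj₁ ∘ f-inj ∘ rank-injective
      ∘ ∸-cancelʳ-≡ (proj₂ (highEnd i)) (proj₂ (highEnd i′))
      ∘ fromℕ<-injective _ _ _ _

vertexNumber : ∀ {j m} → V K[ j × m ] → Fin (j * m)
vertexNumber (a , x) = combine a x

vertexNumber-injective : ∀ {j m} → Injective _≡_ _≡_ (vertexNumber {j} {m})
vertexNumber-injective {x = a , x} {b , y} eq with combine-injective a x b y eq
... | refl , refl = refl

¬Arrows : ∀ {j m n} K → K < n * 2 → j * m ≤ K + 2 → ¬ Arrows j m (matching n) C₇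
¬Arrows {j} {m} {n} K K<2n jm≤K+2 arrows = [ noRed , noBlue ]′ (arrows colouring)
  where
  open ThresholdColouring (vertexNumber {j} {m}) vertexNumber-injective K

  noRed : ¬ MonoCopy (matching n) K[ j × m ] colouring 0F
  noRed = <⇒≱ K<2n ∘ redMatching⇒2n≤K

  noBlue : ¬ MonoCopy C₇ K[ j × m ] colouring 1F
  noBlue blue = <⇒≱ (blueMatching⇒k≤N∸K blueMatching) (m≤n+o⇒m∸n≤o (j * m) K jm≤K+2)
    where
    blueMatching : MonoCopy (matching 3) K[ j × m ] colouring 1F
    blueMatching = MonoCopy-∘ {H = K[ j × m ]} {χ = colouring} matching3↪C₇ blue

arrows⇒2n+2≤jm : ∀ {j m n} → Arrows j m (matching (suc n)) C₇ → 2 * suc n + 2 ≤ j * m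
arrows⇒2n+2≤jm {j} {m} {n} arrows = ≮⇒≥ λ jm<2n+2 →
  ¬Arrows (suc (n * 2)) (n<1+n _) (≤-pred (subst (suc (j * m) ≤_) (rearrange n) jm<2n+2)) arrows
  where
  rearrange : ∀ n → 2 * suc n + 2 ≡ suc (suc (n * 2) + 2)
  rearrange = solve-∀

⌈/⌉-least : ∀ {a b m} → a ≤ suc b * m → ⌈ a / suc b ⌉ ≤ m
⌈/⌉-least {a} {b} {m} a≤bm = ≤-pred (m<n*o⇒m/o<n {o = suc b} a+b<[1+m]b)
  where
  open ≤-Reasoning
  a+b<[1+m]b : a + suc b ∸ 1 < suc m * suc b
  a+b<[1+m]b = begin-strict
    a + suc b ∸ 1   ≡⟨ cong (_∸ 1) (+-suc a b) ⟩
    a + b           ≡⟨ +-comm a b ⟩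
    b + a           ≤⟨ +-monoʳ-≤ b (subst (a ≤_) (*-comm (suc b) m) a≤bm) ⟩
    b + m * suc b   <⟨ n<1+n _ ⟩
    suc m * suc b   ∎

lemma4 : (j n m : ℕ) → (j≥3 : 3 ≤ j) → j ≤ n →
           IsMultipartiteRamsey j (matching n) C₇ m →
           ⌈ 2 * n + 2 / j ⌉ {{>-nonZero (≤-trans (s≤s z≤n) j≥3)}} ≤ m
lemma4 (suc j) zero    m _ () _
lemma4 (suc j) (suc n) m _ _  (_ , arrows , _) = ⌈/⌉-least (arrows⇒2n+2≤jm arrows)
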